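{- Let $T_P$ be a finite set of predicate terms, $T_U$ a finite set of update terms, $AP=\{a_\tau:\tau\in T_P\cup T_U\}$, let $\varphi$ be a universally quantified ($\forall^*$) HyperTSL formula over $T_P,T_U$ and let $S$ be a Mealy machine over $AP$. If $S$ models the HyperLTL formula $\mathrm{transl}(\varphi)$, i.e. $\mathit{traces}(S)\models\mathrm{transl}(\varphi)$, then $S$ models $\varphi$.
   Context: TSL setting. Let $\mathcal V$ be a set of values with Booleans $\mathbb B$. Fix inputs $\mathbb I$, a finite set of cells $\mathbb C$, function symbols $\Sigma_F$ and predicate symbols $\Sigma_P\subseteq\Sigma_F$. Function terms $\tau::=s\mid f\,\tau_1\cdots\tau_n$ ($s\in\mathbb I\cup\mathbb C$), forming $\mathcal T_F$; predicate terms $p\,\tau_1\cdots\tau_n$; update terms $[c\leftarrow\tau]$. An interpretation $\langle\cdot\rangle$ maps symbols to functions $\mathcal V^n\to\mathcal V$ (predicates into $\mathbb B$). A computation is an infinite sequence $\varsigma$ of total maps $\mathbb C\to\mathcal T_F$; an input stream is an infinite sequence $\iota$ of maps $\mathbb I\to\mathcal V$; an execution is $(\varsigma,\iota)$. With initial values $\mathrm{init}_c$, evaluation: $\eta(\varsigma,\iota,i,s)=\iota(i)(s)$ for inputs; $\mathrm{init}_s$ for cells at $i=0$; $\eta(\varsigma,\iota,i-1,\varsigma(i-1)(s))$ for cells at $i>0$; $\eta(\varsigma,\iota,i,f\tau_1\cdots\tau_n)=\langle f\rangle(\eta(\cdot,\tau_1),\dots)$. HyperTSL: $\varphi::=\forall\pi.\varphi\mid\exists\pi.\varphi\mid\psi$,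 $\psi::=\neg\psi\mid\psi\wedge\psi\mid X\psi\mid\psi U\psi\mid(\tau^p)_\pi\mid[c\leftarrow\tau]_\pi$; "over $T_P,T_U$" means all its predicate/update terms lie in $T_P$/$T_U$. Over a set $E$ of executions: $[c\leftarrow\tau]_\pi$ holds at $i$ iff $\varsigma(i)(c)$ is syntactically $\tau$ for $(\varsigma,\iota)=\Pi(\pi)$; $(\tau^p)_\pi$ iff $\eta(\varsigma,\iota,i,\tau^p)$ true; LTL semantics for connectives; quantifiers over $E$; $E\models_{\langle\cdot\rangle}\varphi$ at time 0 with empty assignment. HyperLTL: same shape over traces in $(2^{AP})^\omega$ with atoms $a_\pi$ ($a\in\Pi(\pi)(i)$); $T\models\chi$ for trace sets $T$. Translation: $T_U^c$ = update terms of $T_U$ for cell $c$; $\mathit{cellProps}_\pi:=G\bigwedge_{c\in\mathbb C}\bigvee_{u\in T_U^c}((a_u)_\pi\wedge\bigwedge_{u'\in T_U^c\setminus\{u\}}\neg(a_{u'})_\pi)$ ($G$ = globally). For $\varphi=Q_1\pi_1\cdots Q_n\pi_n.\psi$, $\mathrm{transl}(\varphi)=Q_1\pi_1\cdots Q_n\pi_n.\psi'\wedge\bigwedge_j\mathit{cellProps}_{\pi_j}$, with $\psi'$ replacing each $(\tau)_\pi$ by $(a_\tau)_\pi$. For an interpretation and execution $e=(\varsigma,\iota)$, $\mathrm{transl}_{\langle\cdot\rangle}(e)$ has $i$-th letter $\{a_\tau:\tau\in T_P,\eta(\varsigma,\iota,i,\tau)\text{ true}\}\cup\{a_{[c\leftarrow\tau]}:[c\leftarrow\tau]\in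 T_U,\varsigma(i)(c)\equiv\tau\}$. Mealy machine: $S=(Q,2^{AP},\delta,q_0)$ with $\delta\subseteq Q\times 2^{AP}\times Q$; $\mathit{traces}(S)$ = label sequences of infinite paths from $q_0$. $S$ models the HyperTSL formula $\varphi$ iff for every interpretation $\langle\cdot\rangle$, $\{(\varsigma,\iota):\mathrm{transl}_{\langle\cdot\rangle}((\varsigma,\iota))\in\mathit{traces}(S)\}\models_{\langle\cdot\rangle}\varphi$. -}

module Defs where

open import Data.Nat using (ℕ; zero; suc; _≤_; _<_)
open import Data.Fin using (Fin; _≟_) renaming (zero to fz; suc to fs)
open import Data.Bool using (Bool; true; false; T)
open import Data.Vec using (Vec; []; _∷_)
open import Data.List using (List; []; _∷_; map; foldr; filter; allFin)
open import Data.List.Membership.Propositional using (_∈_)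
open import Data.List.Relation.Unary.All using (All)
open import Data.Product using (Σ; ∃; _×_; _,_)
open import Data.Sum using (_⊎_; inj₁; inj₂)
open import Data.Empty using (⊥)
open import Relation.Nullary using (¬_)
open import Relation.Binary.PropositionalEquality using (_≡_)

picks : {A : Set} → List A → List (A × List A)
picks [] = []
picks (x ∷ xs) = (x , xs) ∷ map (λ p → Σ.proj₁ p , x ∷ Σ.proj₂ p) (picks xs)

-- extend a variable assignment (de Bruijn: the newest variable is fz)
_∷ₐ_ : {A : Set} {n : ℕ} → A → (Fin n → A) → Fin (suc n) → A
(a ∷ₐ Π) fz = a
(a ∷ₐ Π) (fs j) = Π j

-- HyperLTL over an atom type A; traces are sequences of letters in 2^A,
-- a letter being represented by its characteristic function A → Bool.
-- Path variables are de Bruijn indices (Fin n), so closed formulas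
-- have type HLTL 0.

module HyperLTL (A : Set) where

  Letter : Set
  Letter = A → Bool

  Trace : Set
  Trace = ℕ → Letter

  infixr 6 _∧ₗ_
  data LQF (n : ℕ) : Set where
    ⊤ₗ    : LQF n
    ¬ₗ_   : LQF n → LQF n
    _∧ₗ_  : LQF n → LQF n → LQF n
    Xₗ    : LQF n → LQF n
    _Uₗ_  : LQF n → LQF n → LQF n
    atom  : A → Fin n → LQF n

  data HLTL (n : ℕ) : Set where
    ∀ₗ    : HLTL (suc n) → HLTL n
    ∃ₗ    : HLTL (suc n) → HLTL n
    bodyₗ : LQF n → HLTL n

  ⊥ₗ : {n : ℕ} → LQF n
  ⊥ₗ = ¬ₗ ⊤ₗ

  _∨ₗ_ : {n : ℕ} → LQF n → LQF n → LQF n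
  a ∨ₗ b = ¬ₗ ((¬ₗ a) ∧ₗ (¬ₗ b))

  Gₗ : {n : ℕ} → LQF n → LQF n
  Gₗ ψ = ¬ₗ (⊤ₗ Uₗ (¬ₗ ψ))

  ⋀ₗ : {n : ℕ} → List (LQF n) → LQF n
  ⋀ₗ = foldr _∧ₗ_ ⊤ₗ

  ⋁ₗ : {n : ℕ} → List (LQF n) → LQF n
  ⋁ₗ = foldr _∨ₗ_ ⊥ₗ

  semQ : {n : ℕ} → (Fin n → Trace) → ℕ → LQF n → Set
  semQ Π i ⊤ₗ = Data.Unit.⊤
    where import Data.Unit
  semQ Π i (¬ₗ ψ) = ¬ semQ Π i ψ
  semQ Π i (ψ ∧ₗ χ) = semQ Π i ψ × semQ Π i χ
  semQ Π i (Xₗ ψ) = semQ Π (suc i) ψ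
  semQ Π i (ψ Uₗ χ) =
    ∃ λ j → i ≤ j × semQ Π j χ × (∀ k → i ≤ k → k < j → semQ Π k ψ)
  semQ Π i (atom a π) = Π π i a ≡ true

  sem : {n : ℕ} → (Trace → Set) → (Fin n → Trace) → ℕ → HLTL n → Set
  sem T Π i (∀ₗ φ) = ∀ t → T t → sem T (t ∷ₐ Π) i φ
  sem T Π i (∃ₗ φ) = ∃ λ t → T t × sem T (t ∷ₐ Π) i φ
  sem T Π i (bodyₗ ψ) = semQ Π i ψ

  _⊨ₗ_ : (Trace → Set) → HLTL 0 → Set
  T ⊨ₗ χ = sem T (λ ()) 0 χ

  record Mealy : Set₁ where
    field
      Q  : Set
      δ  : Q → Letter → Q → Set
      q₀ : Q

  InTraces : Mealy → Trace → Set
  InTraces S = λ t → ∃ λ (p : ℕ → Q) → p 0 ≡ q₀ × (∀ i → δ (p i) (t i) (p (suc i)))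
    where open Mealy S

-- I      : inputs
--   F      : function symbols Σ_F, with arities
--   isPred : marks the predicate symbols Σ_P ⊆ Σ_F
--   V      : values, containing the Booleans trueV ≠ falseV
--   k      : number of cells; the finite set of cells is Fin k
--   init   : initial values of the cells

module TSL (I : Set) (F : Set) (arity : F → ℕ) (isPred : F → Bool)
           (V : Set) (trueV falseV : V) (k : ℕ) (init : Fin k → V) where

  Cell : Set
  Cell = Fin k

  data FTerm : Set where
    inp  : I → FTerm
    cell : Cell → FTerm
    app  : (f : F) → Vec FTerm (arity f) → FTerm

  record PTerm : Set where
    constructor pterm
    field
      psym  : F
      ispred : T (isPred psym)
      pargs : Vec FTerm (arity psym)

  record UTerm : Set where
    constructor [_←_]
    field
      ucell : Cell
      uterm : FTerm

  record Interp : Set where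
    field
      ⟦_⟧    : (f : F) → Vec V (arity f) → V
      predB : (p : F) → T (isPred p) → (vs : Vec V (arity p)) →
              (⟦ p ⟧ vs ≡ trueV) ⊎ (⟦ p ⟧ vs ≡ falseV)

  Computation : Set
  Computation = ℕ → Cell → FTerm

  InputStream : Set
  InputStream = ℕ → I → V

  Execution : Set
  Execution = Computation × InputStream

  module Eval (⟨⟩ : Interp) (ς : Computation) (ι : InputStream) where
    open Interp ⟨⟩
    mutual
      η : ℕ → FTerm → V
      η i (inp s) = ι i s
      η zero (cell c) = init c
      η (suc i) (cell c) = η i (ς i c)
      η i (app f ts) = ⟦ f ⟧ (ηs i ts)

      ηs : {m : ℕ} → ℕ → Vec FTerm m → Vec V m
      ηs i [] = []
      ηs i (t ∷ ts) = η i t ∷ ηs i ts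

    ηP : ℕ → PTerm → Set
    ηP i (pterm p _ ts) = ⟦ p ⟧ (ηs i ts) ≡ trueV

  PredTrue : Interp → Execution → ℕ → PTerm → Set
  PredTrue ⟨⟩ (ς , ι) i τ = Eval.ηP ⟨⟩ ς ι i τ

  infixr 6 _∧ₜ_
  data TQF (n : ℕ) : Set where
    ¬ₜ_   : TQF n → TQF n
    _∧ₜ_  : TQF n → TQF n → TQF n
    Xₜ    : TQF n → TQF n
    _Uₜ_  : TQF n → TQF n → TQF n
    predₜ : PTerm → Fin n → TQF n
    updₜ  : UTerm → Fin n → TQF n

  data HTSL (n : ℕ) : Set where
    ∀ₜ    : HTSL (suc n) → HTSL n
    ∃ₜ    : HTSL (suc n) → HTSL n
    bodyₜ : TQF n → HTSL n

  data Universal : {n : ℕ} → HTSL n → Set where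
    univ-∀    : {n : ℕ} {φ : HTSL (suc n)} → Universal φ → Universal (∀ₜ φ)
    univ-body : {n : ℕ} {ψ : TQF n} → Universal (bodyₜ ψ)

  OverQ : {n : ℕ} → List PTerm → List UTerm → TQF n → Set
  OverQ TP TU (¬ₜ ψ) = OverQ TP TU ψ
  OverQ TP TU (ψ ∧ₜ χ) = OverQ TP TU ψ × OverQ TP TU χ
  OverQ TP TU (Xₜ ψ) = OverQ TP TU ψ
  OverQ TP TU (ψ Uₜ χ) = OverQ TP TU ψ × OverQ TP TU χ
  OverQ TP TU (predₜ τ π) = τ ∈ TP
  OverQ TP TU (updₜ u π) = u ∈ TU

  Over : {n : ℕ} → List PTerm → List UTerm → HTSL n → Set
  Over TP TU (∀ₜ φ) = Over TP TU φ
  Over TP TU (∃ₜ φ) = Over TP TU φ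
  Over TP TU (bodyₜ ψ) = OverQ TP TU ψ

  semQT : {n : ℕ} → Interp → (Fin n → Execution) → ℕ → TQF n → Set
  semQT ⟨⟩ Π i (¬ₜ ψ) = ¬ semQT ⟨⟩ Π i ψ
  semQT ⟨⟩ Π i (ψ ∧ₜ χ) = semQT ⟨⟩ Π i ψ × semQT ⟨⟩ Π i χ
  semQT ⟨⟩ Π i (Xₜ ψ) = semQT ⟨⟩ Π (suc i) ψ
  semQT ⟨⟩ Π i (ψ Uₜ χ) =
    ∃ λ j → i ≤ j × semQT ⟨⟩ Π j χ × (∀ m → i ≤ m → m < j → semQT ⟨⟩ Π m ψ)
  semQT ⟨⟩ Π i (predₜ τ π) = PredTrue ⟨⟩ (Π π) i τ
  semQT ⟨⟩ Π i (updₜ [ c ← τ ] π) = Σ.proj₁ (Π π) i c ≡ τ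

  semT : {n : ℕ} → Interp → (Execution → Set) → (Fin n → Execution) → ℕ → HTSL n → Set
  semT ⟨⟩ E Π i (∀ₜ φ) = ∀ e → E e → semT ⟨⟩ E (e ∷ₐ Π) i φ
  semT ⟨⟩ E Π i (∃ₜ φ) = ∃ λ e → E e × semT ⟨⟩ E (e ∷ₐ Π) i φ
  semT ⟨⟩ E Π i (bodyₜ ψ) = semQT ⟨⟩ Π i ψ

  _⊨[_]_ : (Execution → Set) → Interp → HTSL 0 → Set
  E ⊨[ ⟨⟩ ] φ = semT ⟨⟩ E (λ ()) 0 φ

  Atom : Set
  Atom = PTerm ⊎ UTerm

  open HyperLTL Atom public

  InAP : List PTerm → List UTerm → Atom → Set
  InAP TP TU (inj₁ τ) = τ ∈ TP
  InAP TP TU (inj₂ u) = u ∈ TU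

  MealyOver : List PTerm → List UTerm → Mealy → Set
  MealyOver TP TU S = ∀ q l q' → Mealy.δ S q l q' → ∀ a → l a ≡ true → InAP TP TU a

  TUof : List UTerm → Cell → List UTerm
  TUof TU c = filter (λ u → UTerm.ucell u ≟ c) TU

  cellProps : {n : ℕ} → List UTerm → Fin n → LQF n
  cellProps TU π =
    Gₗ (⋀ₗ (map (λ c →
          ⋁ₗ (map (λ p → atom (inj₂ (Σ.proj₁ p)) π
                        ∧ₗ ⋀ₗ (map (λ u' → ¬ₗ atom (inj₂ u') π) (Σ.proj₂ p)))
                  (picks (TUof TU c))))
        (allFin k)))

  translQ : {n : ℕ} → TQF n → LQF n
  translQ (¬ₜ ψ) = ¬ₗ translQ ψ
  translQ (ψ ∧ₜ χ) = translQ ψ ∧ₗ translQ χ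
  translQ (Xₜ ψ) = Xₗ (translQ ψ)
  translQ (ψ Uₜ χ) = translQ ψ Uₗ translQ χ
  translQ (predₜ τ π) = atom (inj₁ τ) π
  translQ (updₜ u π) = atom (inj₂ u) π

  transl : {n : ℕ} → List UTerm → HTSL n → HLTL n
  transl TU (∀ₜ φ) = ∀ₗ (transl TU φ)
  transl TU (∃ₜ φ) = ∃ₗ (transl TU φ)
  transl {n} TU (bodyₜ ψ) = bodyₗ (translQ ψ ∧ₗ ⋀ₗ (map (cellProps TU) (allFin n)))

  -- the i-th letter of transl_⟨⟩(e) contains the atom a
  TranslHolds : Interp → List PTerm → List UTerm → Execution → ℕ → Atom → Set
  TranslHolds ⟨⟩ TP TU e i (inj₁ τ) = τ ∈ TP × PredTrue ⟨⟩ e i τ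
  TranslHolds ⟨⟩ TP TU (ς , ι) i (inj₂ [ c ← τ ]) =
    [ c ← τ ] ∈ TU × ς i c ≡ τ

  IsTransl : Interp → List PTerm → List UTerm → Execution → Trace → Set
  IsTransl ⟨⟩ TP TU e t =
    ∀ i a → (t i a ≡ true → TranslHolds ⟨⟩ TP TU e i a)
          × (TranslHolds ⟨⟩ TP TU e i a → t i a ≡ true)

  TranslInTraces : Interp → List PTerm → List UTerm → Mealy → Execution → Set
  TranslInTraces ⟨⟩ TP TU S e = ∃ λ t → IsTransl ⟨⟩ TP TU e t × InTraces S t

  ModelsTSL : List PTerm → List UTerm → Mealy → HTSL 0 → Set
  ModelsTSL TP TU S φ = (⟨⟩ : Interp) → TranslInTraces ⟨⟩ TP TU S ⊨[ ⟨⟩ ] φ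

{-# OPTIONS --safe #-}
module Submission where

-- An execution whose translation is a trace of S is matched, quantifier by
-- quantifier, by that very trace on the HyperLTL side. Under such a matching
-- an atom a_τ holds on a trace exactly when τ holds on the corresponding
-- execution, so ψ' and ψ agree at every time point; the cellProps conjuncts of
-- transl φ are simply discarded.

open import Defs
open import Data.Nat using (ℕ; suc)
open import Data.Fin using (Fin) renaming (zero to fz; suc to fs)
open import Data.Bool using (Bool)
open import Data.List using (List)
open import Data.List.Relation.Unary.Unique.Propositional using (Unique)
open import Data.Product using (_,_; proj₁; proj₂)
open import Data.Sum using (inj₁; inj₂)
open import Function.Bundles using (_⇔_; mk⇔; Equivalence)
open import Relation.Nullary using (¬_)
open import Relation.Binary.PropositionalEquality using (_≡_)

module TranslSoundness (I F : Set) (arity : F → ℕ) (isPred : F → Bool)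
    (V : Set) (trueV falseV : V) (k : ℕ) (init : Fin k → V) where
  open TSL I F arity isPred V trueV falseV k init
  open Equivalence

  module _ (⟨⟩ : Interp) (TP : List PTerm) (TU : List UTerm) where

    Translates : {n : ℕ} → (Fin n → Execution) → (Fin n → Trace) → Set
    Translates Πe Πt = ∀ π → IsTransl ⟨⟩ TP TU (Πe π) (Πt π)

    Translates-∷ : {n : ℕ} {Πe : Fin n → Execution} {Πt : Fin n → Trace}
                   {e : Execution} {t : Trace} →
                   IsTransl ⟨⟩ TP TU e t → Translates Πe Πt →
                   Translates (e ∷ₐ Πe) (t ∷ₐ Πt)
    Translates-∷ isT R fz = isT
    Translates-∷ isT R (fs π) = R π

    semQ-translQ : {n : ℕ} {Πe : Fin n → Execution} {Πt : Fin n → Trace} →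
                   Translates Πe Πt → (ψ : TQF n) → OverQ TP TU ψ →
                   ∀ i → semQ Πt i (translQ ψ) ⇔ semQT ⟨⟩ Πe i ψ
    semQ-translQ R (¬ₜ ψ) o i =
      mk⇔ (λ ¬h h → ¬h (from (semQ-translQ R ψ o i) h))
          (λ ¬h h → ¬h (to (semQ-translQ R ψ o i) h))
    semQ-translQ R (ψ ∧ₜ χ) (oψ , oχ) i =
      mk⇔ (λ (a , b) → to (semQ-translQ R ψ oψ i) a , to (semQ-translQ R χ oχ i) b)
          (λ (a , b) → from (semQ-translQ R ψ oψ i) a , from (semQ-translQ R χ oχ i) b)
    semQ-translQ R (Xₜ ψ) o i = semQ-translQ R ψ o (suc i)
    semQ-translQ R (ψ Uₜ χ) (oψ , oχ) i =
      mk⇔ (λ (j , i≤j , χj , ψ<j) →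
             j , i≤j , to (semQ-translQ R χ oχ j) χj ,
             λ m i≤m m<j → to (semQ-translQ R ψ oψ m) (ψ<j m i≤m m<j))
          (λ (j , i≤j , χj , ψ<j) →
             j , i≤j , from (semQ-translQ R χ oχ j) χj ,
             λ m i≤m m<j → from (semQ-translQ R ψ oψ m) (ψ<j m i≤m m<j))
    semQ-translQ R (predₜ τ π) o i =
      mk⇔ (λ h → proj₂ (proj₁ (R π i (inj₁ τ)) h))
          (λ h → proj₂ (R π i (inj₁ τ)) (o , h))
    semQ-translQ R (updₜ u π) o i =
      mk⇔ (λ h → proj₂ (proj₁ (R π i (inj₂ u)) h))
          (λ h → proj₂ (R π i (inj₂ u)) (o , h))

    sem-transl⇒semT : (S : Mealy) {n : ℕ} {Πe : Fin n → Execution} {Πt : Fin n → Trace} →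
                      Translates Πe Πt →
                      (φ : HTSL n) → Universal φ → Over TP TU φ →
                      sem (InTraces S) Πt 0 (transl TU φ) →
                      semT ⟨⟩ (TranslInTraces ⟨⟩ TP TU S) Πe 0 φ
    sem-transl⇒semT S R (∀ₜ φ) (univ-∀ u) o h e (t , isT , t∈S) =
      sem-transl⇒semT S (Translates-∷ isT R) φ u o (h t t∈S)
    sem-transl⇒semT S R (bodyₜ ψ) univ-body o (ψ' , _) =
      to (semQ-translQ R ψ o 0) ψ'

theorem6 : (I F : Set) (arity : F → ℕ) (isPred : F → Bool)
           (V : Set) (trueV falseV : V) → ¬ (trueV ≡ falseV) →
           (k : ℕ) (init : Fin k → V) →
           let open TSL I F arity isPred V trueV falseV k init in
           (TP : List PTerm) (TU : List UTerm) → Unique TP → Unique TU →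
           (φ : HTSL 0) → Universal φ → Over TP TU φ →
           (S : Mealy) → MealyOver TP TU S →
           InTraces S ⊨ₗ transl TU φ →
           ModelsTSL TP TU S φ
theorem6 I F arity isPred V trueV falseV _ k init TP TU _ _ φ u o S _ S⊨transl ⟨⟩ =
  TranslSoundness.sem-transl⇒semT I F arity isPred V trueV falseV k init
    ⟨⟩ TP TU S {Πe = λ ()} {Πt = λ ()} (λ ()) φ u o S⊨transl
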